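{- For every positive integer $k$, the game $\mathcal{O}$-saturation number of $K_{2k}$ satisfies $\mathrm{sat}_g(\mathcal{O};K_{2k})=\mathrm{sat}_g'(\mathcal{O};K_{2k})=k^2$, and this also equals $\mathrm{ex}(\mathcal{O};2k)$, the maximum number of edges in a $2k$-vertex graph with no odd cycle.
   Context: Let $\mathcal{F}$ be a family of graphs and $H$ a host graph. A subgraph $G\subseteq H$ is $\mathcal{F}$-saturated relative to $H$ if no subgraph of $G$ belongs to $\mathcal{F}$ but adding any edge of $E(H)-E(G)$ to $G$ creates a subgraph in $\mathcal{F}$. In the $\mathcal{F}$-saturation game on $H$, two players Max and Min alternately add one edge of $H$ to a graph $G$ (initially with vertex set $V(H)$ and no edges), subject to $G$ never containing a subgraph in $\mathcal{F}$; the game ends when $G$ becomes $\mathcal{F}$-saturated relative to $H$. Max tries to maximize and Min to minimize the number of edges played. Under optimal play, the length of the game is denoted $\mathrm{sat}_g(\mathcal{F};H)$ when Max moves first and $\mathrm{sat}_g'(\mathcal{F};H)$ when Min moves first. Here $\mathcal{O}$ denotes the family of all odd cycles and $K_{2k}$ the complete graph on $2k$ vertices. -}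

module Defs where

open import Data.Nat using (ℕ; zero; suc; _+_; _*_; _≤_)
open import Data.Fin using (Fin; inject₁; fromℕ) renaming (zero to fzero; suc to fsuc)
open import Data.Product using (Σ; _×_; _,_)
open import Data.Sum using (_⊎_)
open import Data.List using (List; []; _∷_; length)
open import Data.List.Membership.Propositional using (_∈_)
open import Data.List.Relation.Unary.All using (All)
open import Data.List.Relation.Unary.AllPairs using (AllPairs)
open import Relation.Nullary using (¬_)
open import Relation.Binary.PropositionalEquality using (_≡_; _≢_)
open import Function.Definitions using (Injective)

-- A graph on vertex set Fin n, given as a list of edges (ordered pairs read as
-- unordered edges).
Edge : ℕ → Set
Edge n = Fin n × Fin n

EdgeList : ℕ → Set
EdgeList n = List (Edge n)

Adj : ∀ {n} → EdgeList n → Fin n → Fin n → Set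
Adj G u v = ((u , v) ∈ G) ⊎ ((v , u) ∈ G)

SameEdge : ∀ {n} → Edge n → Edge n → Set
SameEdge (u , v) (u' , v') = ((u ≡ u') × (v ≡ v')) ⊎ ((u ≡ v') × (v ≡ u'))

IsSimple : ∀ {n} → EdgeList n → Set
IsSimple G = All (λ e → Data.Product.proj₁ e ≢ Data.Product.proj₂ e) G
           × AllPairs (λ e f → ¬ SameEdge e f) G

-- An odd cycle of length 3 + 2j in G: distinct vertices c 0, ..., c (2+2j),
-- consecutive ones adjacent, and the last adjacent to the first.
OddCycleOfLen : ∀ {n} → EdgeList n → ℕ → Set
OddCycleOfLen {n} G j =
  Σ (Fin (suc (2 + 2 * j)) → Fin n) λ c →
      Injective _≡_ _≡_ c
    × ((i : Fin (2 + 2 * j)) → Adj G (c (inject₁ i)) (c (fsuc i)))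
    × Adj G (c (fromℕ (2 + 2 * j))) (c fzero)

HasOddCycle : ∀ {n} → EdgeList n → Set
HasOddCycle G = Σ ℕ λ j → OddCycleOfLen G j

OddCycleFree : ∀ {n} → EdgeList n → Set
OddCycleFree G = ¬ HasOddCycle G

-- A legal move in the O-saturation game on the host K_n: an edge of K_n
-- not yet in G whose addition creates no odd cycle.
Legal : ∀ {n} → EdgeList n → Edge n → Set
Legal G (u , v) = (u ≢ v) × ¬ Adj G u v × OddCycleFree ((u , v) ∷ G)

GameOver : ∀ {n} → EdgeList n → Set
GameOver G = ∀ e → ¬ Legal G e

data Player : Set where
  Max Min : Player

-- Max (playing optimally) can guarantee that the game ends with at least t
-- edges, starting from position G with player p to move.
data MaxForces {n} (t : ℕ) : Player → EdgeList n → Set where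
  over  : ∀ {p G} → GameOver G → t ≤ length G → MaxForces t p G
  maxMv : ∀ {G} e → Legal G e → MaxForces t Min (e ∷ G) → MaxForces t Max G
  minMv : ∀ {G} e₀ → Legal G e₀ →
          (∀ e → Legal G e → MaxForces t Max (e ∷ G)) → MaxForces t Min G

-- Min (playing optimally) can guarantee that the game ends with at most t
-- edges, starting from position G with player p to move.
data MinForces {n} (t : ℕ) : Player → EdgeList n → Set where
  over  : ∀ {p G} → GameOver G → length G ≤ t → MinForces t p G
  minMv : ∀ {G} e → Legal G e → MinForces t Max (e ∷ G) → MinForces t Min G
  maxMv : ∀ {G} e₀ → Legal G e₀ →
          (∀ e → Legal G e → MinForces t Min (e ∷ G)) → MinForces t Max G

-- GameValue Max n t  :  sat_g (O ; K_n) = t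
-- GameValue Min n t  :  sat_g'(O ; K_n) = t
GameValue : Player → ℕ → ℕ → Set
GameValue p n t = MaxForces {n} t p [] × MinForces {n} t p []

ExValue : ℕ → ℕ → Set
ExValue n t =
    (Σ (EdgeList n) λ G → IsSimple G × OddCycleFree G × length G ≡ t)
  × ((G : EdgeList n) → IsSimple G → OddCycleFree G → length G ≤ t)

-- A graph has no odd cycle iff it is properly 2-colourable, so every position is a simple
-- bipartite graph with colour classes T, F, |T| + |F| = 2k, hence has at most
-- |T|·|F| ≤ k² edges.  This bounds ex(O ; 2k) (attained by K_{k,k}) and every play of
-- the game, which is Min's side of both game values.
-- For Max's side, Max fixes a perfect matching and keeps every matched pair either joined
-- (one component, opposite colours) or made of two isolated vertices, re-pairing when Min
-- links isolated vertices of two different pairs.  When the game ends all pairs are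
-- joined, so the matching swaps the colours and |T| = |F| = k, and every pair of
-- opposite colours is an edge (else adding it would be legal): k² edges.
-- Positions are tracked by a certificate (Bipartition: component labels, a proper
-- colouring, connecting paths), which decides legality and is updated after each move.
module Submission where

open import Defs
open import Data.Nat using (ℕ; zero; suc; _+_; _*_; _∸_; _≤_; z≤n; s≤s)
open import Data.Nat.Properties
  using (+-suc; +-identityʳ; +-comm; +-assoc; *-comm; ≤-refl; ≤-trans; ≤-antisym; ≤-total; <-irrefl;
         <-cmp; +-mono-<; +-monoˡ-≤; +-cancelˡ-≡; +-cancelˡ-≤; m≤m+n; m+[n∸m]≡n)
open import Data.Nat.Tactic.RingSolver using (solve-∀)
open import Data.Bool using (Bool; true; false; not; _xor_; if_then_else_)
import Data.Bool as Bool
open import Data.Bool.Properties using (not-involutive; ¬-not; not-¬; xor-assoc; xor-same; xor-identityʳ)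
open import Data.Fin using (Fin; _≟_; toℕ; inject₁; fromℕ) renaming (zero to fzero; suc to fsuc)
open import Data.Fin.Properties using (toℕ-fromℕ; any?; suc-injective)
open import Data.Fin.Permutation.Components using (transpose; transpose-inverse)
open import Data.Product using (Σ; _×_; _,_; proj₁; proj₂)
open import Data.Product.Properties using (≡-dec)
open import Data.Sum using (_⊎_; inj₁; inj₂)
open import Data.List using (List; []; _∷_; length; map; filter; allFin; cartesianProduct; _++_)
open import Data.List.Properties using (length-map; length-++; length-tabulate; length-removeAt′)
open import Data.List.Membership.Propositional using (_∈_; _∉_; _─_)
open import Data.List.Membership.Propositional.Properties
  using (∈-++⁻; ∈-map⁺; ∈-map⁻; ∈-allFin; ∈-filter⁺; ∈-filter⁻; ∈-cartesianProduct⁺; ∈-cartesianProduct⁻)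
open import Data.List.Relation.Unary.Any using (here; there; index)
open import Data.List.Relation.Unary.All using ([]; _∷_)
import Data.List.Relation.Unary.All as All
open import Data.List.Relation.Unary.AllPairs using ([]; _∷_)
import Data.List.Relation.Unary.AllPairs as AllPairs
import Data.List.Relation.Unary.AllPairs.Properties as AllPairsₚ
open import Data.List.Relation.Unary.Unique.Propositional using (Unique)
open import Data.List.Relation.Unary.Unique.Propositional.Properties
  using (allFin⁺; cartesianProduct⁺; map⁺; filter⁺)
open import Data.Empty using (⊥; ⊥-elim)
open import Relation.Nullary using (¬_; Dec; yes; no)
open import Relation.Nullary.Decidable using (dec-true; dec-false; _×-dec_; _⊎-dec_; _→-dec_; ¬?)
open import Relation.Binary.PropositionalEquality
open import Function using (_∘_)
open import Function.Definitions using (Injective)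
open import Relation.Binary.Definitions using (tri<; tri≈; tri>)

-- A duplicate-free list contained in ys is no longer than ys: remove the head of xs from
-- ys and recurse.
unique-⊆⇒length≤ : ∀ {A : Set} {xs ys : List A} → Unique xs → (∀ {z} → z ∈ xs → z ∈ ys) →
                   length xs ≤ length ys
unique-⊆⇒length≤ {xs = []} _ _ = z≤n
unique-⊆⇒length≤ {A} {x ∷ xs} {ys} (x∉xs ∷ uniq) xs⊆ys =
  subst (suc (length xs) ≤_) (sym (length-removeAt′ ys (index x∈ys)))
    (s≤s (unique-⊆⇒length≤ uniq λ z∈xs → ∈-─ x∈ys (xs⊆ys (there z∈xs)) (≢-sym (All.lookup x∉xs z∈xs))))
  where
    x∈ys = xs⊆ys (here refl)
    ∈-─ : ∀ {y z : A} {zs} (p : y ∈ zs) → z ∈ zs → z ≢ y → z ∈ zs ─ p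
    ∈-─ (here refl) (here refl) z≢y = ⊥-elim (z≢y refl)
    ∈-─ (here refl) (there q) _ = q
    ∈-─ (there p) (here refl) _ = here refl
    ∈-─ (there p) (there q) z≢y = there (∈-─ p q z≢y)

length-cartesianProduct : ∀ {A B : Set} (xs : List A) (ys : List B) →
                          length (cartesianProduct xs ys) ≡ length xs * length ys
length-cartesianProduct [] ys = refl
length-cartesianProduct (x ∷ xs) ys = begin
  length (map (x ,_) ys ++ cartesianProduct xs ys)    ≡⟨ length-++ (map (x ,_) ys) ⟩
  length (map (x ,_) ys) + length (cartesianProduct xs ys)
    ≡⟨ cong₂ _+_ (length-map (x ,_) ys) (length-cartesianProduct xs ys) ⟩
  length ys + length xs * length ys                     ∎
  where open ≡-Reasoning

-- Arithmetic: if a ≤ k and a + b = 2k then ab ≤ k², since ab + (k - a)² = k².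
product≤square-ordered : ∀ a b k → a ≤ k → a + b ≡ k + k → a * b ≤ k * k
product≤square-ordered a b k a≤k a+b≡2k = subst₂ _≤_ ab≡ sq≡ (m≤m+n (a * (d + k)) (d * d))
  where
    d = k ∸ a
    a+d≡k : a + d ≡ k
    a+d≡k = m+[n∸m]≡n a≤k
    ab≡ : a * (d + k) ≡ a * b
    ab≡ = cong (a *_) (+-cancelˡ-≡ a (d + k) b (begin
      a + (d + k) ≡⟨ +-assoc a d k ⟨
      a + d + k   ≡⟨ cong (_+ k) a+d≡k ⟩
      k + k       ≡⟨ a+b≡2k ⟨
      a + b       ∎))
      where open ≡-Reasoning
    expand : ∀ a d → a * (d + (a + d)) + d * d ≡ (a + d) * (a + d)
    expand = solve-∀
    sq≡ : a * (d + k) + d * d ≡ k * k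
    sq≡ = subst (λ m → a * (d + m) + d * d ≡ m * m) a+d≡k (expand a d)

product≤square : ∀ a b k → a + b ≡ k + k → a * b ≤ k * k
product≤square a b k a+b≡2k with ≤-total a k
... | inj₁ a≤k = product≤square-ordered a b k a≤k a+b≡2k
... | inj₂ k≤a = subst (_≤ k * k) (*-comm b a)
      (product≤square-ordered b a k b≤k (trans (+-comm b a) a+b≡2k))
  where
    b≤k : b ≤ k
    b≤k = +-cancelˡ-≤ k b k (subst (k + b ≤_) a+b≡2k (+-monoˡ-≤ b k≤a))

half : ∀ a k → a + a ≡ k + k → a ≡ k
half a k a+a≡k+k with <-cmp a k
... | tri< a<k _ _ = ⊥-elim (<-irrefl a+a≡k+k (+-mono-< a<k a<k))
... | tri≈ _ a≡k _ = a≡k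
... | tri> _ _ k<a = ⊥-elim (<-irrefl (sym a+a≡k+k) (+-mono-< k<a k<a))

-- A cycle of length 3 + 2j returns after 2 + 2j = 2(j + 1) steps.
double : ∀ j → 2 + 2 * j ≡ suc j + suc j
double = solve-∀

true≢false : true ≢ false
true≢false ()

flips : ℕ → Bool → Bool
flips zero b = b
flips (suc m) b = not (flips m b)

flips-not : ∀ m b → flips m (not b) ≡ not (flips m b)
flips-not zero b = refl
flips-not (suc m) b = cong not (flips-not m b)

flips-even : ∀ j b → flips (j + j) b ≡ b
flips-even zero b = refl
flips-even (suc j) b rewrite +-suc j j = trans (not-involutive _) (flips-even j b)

flips-fixed⇒even : ∀ m b → flips m b ≡ b → Σ ℕ λ j → m ≡ j + j
flips-fixed⇒even zero b _ = 0 , refl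
flips-fixed⇒even (suc zero) b eq = ⊥-elim (not-¬ refl (sym eq))
flips-fixed⇒even (suc (suc m)) b eq with flips-fixed⇒even m b (trans (sym (not-involutive _)) eq)
... | j , refl = suc j , cong suc (sym (+-suc j j))

alternating : ∀ {N} (f : Fin (suc N) → Bool) → (∀ i → f (fsuc i) ≡ not (f (inject₁ i))) →
              ∀ i → f i ≡ flips (toℕ i) (f fzero)
alternating f alt fzero = refl
alternating {suc N} f alt (fsuc i) =
  trans (alt i) (cong not (alternating (λ x → f (inject₁ x)) (λ x → alt (inject₁ x)) i))

module _ {n : ℕ} where

  Adj-weaken : ∀ {G : EdgeList n} {e u v} → Adj G u v → Adj (e ∷ G) u v
  Adj-weaken (inj₁ p) = inj₁ (there p)
  Adj-weaken (inj₂ p) = inj₂ (there p)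

  Proper : (Fin n → Bool) → EdgeList n → Set
  Proper c G = ∀ {u v} → (u , v) ∈ G → c u ≢ c v

  proper-Adj : ∀ {c G u v} → Proper c G → Adj G u v → c u ≢ c v
  proper-Adj proper (inj₁ p) = proper p
  proper-Adj proper (inj₂ p) eq = proper p (sym eq)

  -- Along a cycle of length 3 + 2j the colours alternate, so the colour after
  -- 2 + 2j steps equals the first one; the closing edge then joins equal colours.
  proper⇒oddCycleFree : ∀ {c G} → Proper c G → OddCycleFree G
  proper⇒oddCycleFree {c} proper (j , cyc , _ , adj , closing) =
    proper-Adj proper closing (trans last-colour (flips-even (suc j) _))
    where
      colours : Fin (suc (2 + 2 * j)) → Bool
      colours i = c (cyc i)
      last-colour : colours (fromℕ (2 + 2 * j)) ≡ flips (suc j + suc j) (colours fzero)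
      last-colour = trans (alternating colours (λ i → ¬-not (≢-sym (proper-Adj proper (adj i)))) _)
                          (cong (λ m → flips m (colours fzero)) (trans (toℕ-fromℕ _) (double j)))

  data Path (G : EdgeList n) : Fin n → Fin n → ℕ → List (Fin n) → Set where
    stay : ∀ {u} → Path G u u 0 (u ∷ [])
    step : ∀ {u w v m xs} → Adj G u w → u ∉ xs → Path G w v m xs → Path G u v (suc m) (u ∷ xs)

  Reachable : EdgeList n → Fin n → Fin n → Set
  Reachable G u v = Σ ℕ λ m → Σ (List (Fin n)) λ xs → Path G u v m xs

  path-weaken : ∀ {G e u v m xs} → Path G u v m xs → Path (e ∷ G) u v m xs
  path-weaken stay = stay
  path-weaken (step a u∉ p) = step (Adj-weaken a) u∉ (path-weaken p)

  path-length0 : ∀ {G u v xs} → Path G u v 0 xs → u ≡ v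
  path-length0 stay = refl

  path-colour : ∀ {c G u v m xs} → Proper c G → Path G u v m xs → c v ≡ flips m (c u)
  path-colour proper stay = refl
  path-colour {c} proper (step {u} {m = m} a _ p) =
    trans (path-colour proper p) (trans (cong (flips m) (¬-not (≢-sym (proper-Adj proper a))))
                                        (flips-not m (c u)))

  path-join : ∀ {G u w w' v m m' xs ys} → Path G u w m xs → Adj G w w' → Path G w' v m' ys →
              (∀ {z} → z ∈ xs → z ∉ ys) → Path G u v (m + suc m') (xs ++ ys)
  path-join stay a q disjoint = step a (disjoint (here refl)) q
  path-join (step {u} a' u∉xs p) a q disjoint =
    step a' u∉xs++ys (path-join p a q (λ z → disjoint (there z)))
    where
      u∉xs++ys : u ∉ _
      u∉xs++ys mem with ∈-++⁻ _ mem
      ... | inj₁ in-xs = u∉xs in-xs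
      ... | inj₂ in-ys = disjoint (here refl) in-ys

  path+edge⇒oddCycle : ∀ {G u v j xs} → Path G u v (2 + 2 * j) xs → HasOddCycle ((u , v) ∷ G)
  path+edge⇒oddCycle {G} {u} {v} {j} p =
    j , vertex p , vertex-injective p , (λ i → Adj-weaken (vertex-adjacent p i)) ,
    subst₂ (Adj ((u , v) ∷ G)) (sym (vertex-last p)) (sym (vertex-first p)) (inj₂ (here refl))
    where
      vertex : ∀ {u v m xs} → Path G u v m xs → Fin (suc m) → Fin n
      vertex {u = u} stay _ = u
      vertex {u = u} (step _ _ _) fzero = u
      vertex (step _ _ p) (fsuc i) = vertex p i
      vertex∈ : ∀ {u v m xs} (p : Path G u v m xs) i → vertex p i ∈ xs
      vertex∈ stay fzero = here refl
      vertex∈ (step _ _ _) fzero = here refl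
      vertex∈ (step _ _ p) (fsuc i) = there (vertex∈ p i)
      vertex-first : ∀ {u v m xs} (p : Path G u v m xs) → vertex p fzero ≡ u
      vertex-first stay = refl
      vertex-first (step _ _ _) = refl
      vertex-last : ∀ {u v m xs} (p : Path G u v m xs) → vertex p (fromℕ m) ≡ v
      vertex-last stay = refl
      vertex-last (step _ _ p) = vertex-last p
      vertex-injective : ∀ {u v m xs} (p : Path G u v m xs) → Injective _≡_ _≡_ (vertex p)
      vertex-injective stay {fzero} {fzero} _ = refl
      vertex-injective (step _ _ _) {fzero} {fzero} _ = refl
      vertex-injective (step _ u∉ p) {fzero} {fsuc j} eq = ⊥-elim (u∉ (subst (_∈ _) (sym eq) (vertex∈ p j)))
      vertex-injective (step _ u∉ p) {fsuc i} {fzero} eq = ⊥-elim (u∉ (subst (_∈ _) eq (vertex∈ p i)))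
      vertex-injective (step _ _ p) {fsuc i} {fsuc j} eq = cong fsuc (vertex-injective p eq)
      vertex-adjacent : ∀ {u v m xs} (p : Path G u v m xs) (i : Fin m) →
                        Adj G (vertex p (inject₁ i)) (vertex p (fsuc i))
      vertex-adjacent (step a _ p) fzero = subst (Adj G _) (sym (vertex-first p)) a
      vertex-adjacent (step _ _ p) (fsuc i) = vertex-adjacent p i

  colourClass : (Fin n → Bool) → Bool → List (Fin n)
  colourClass c b = filter (λ x → c x Bool.≟ b) (allFin n)

  ∈-colourClass : ∀ {c b} x → c x ≡ b → x ∈ colourClass c b
  ∈-colourClass {c} {b} x cx≡b = ∈-filter⁺ (λ y → c y Bool.≟ b) (∈-allFin x) cx≡b

  colourClass-colour : ∀ {c b x} → x ∈ colourClass c b → c x ≡ b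
  colourClass-colour {c} {b} mem = proj₂ (∈-filter⁻ (λ y → c y Bool.≟ b) {xs = allFin n} mem)

  colourClass-unique : ∀ c b → Unique (colourClass c b)
  colourClass-unique c b = filter⁺ (λ y → c y Bool.≟ b) (allFin⁺ n)

  colourClass-sizes : ∀ c → length (colourClass c true) + length (colourClass c false) ≡ n
  colourClass-sizes c = trans (split (allFin n)) (length-tabulate (λ x → x))
    where
      split : ∀ xs → length (filter (λ x → c x Bool.≟ true) xs) + length (filter (λ x → c x Bool.≟ false) xs)
                     ≡ length xs
      split [] = refl
      split (x ∷ xs) with c x
      ... | true = cong suc (split xs)
      ... | false = trans (+-suc _ _) (cong suc (split xs))

  -- An injection reversing colours maps each colour class into the other, so the classes
  -- have the same size.
  colourClasses-equal : ∀ c (p : Fin n → Fin n) → (∀ {x y} → p x ≡ p y → x ≡ y) →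
                        (∀ x → c (p x) ≢ c x) →
                        length (colourClass c true) ≡ length (colourClass c false)
  colourClasses-equal c p p-injective p-swaps = ≤-antisym (into true) (into false)
    where
      into : ∀ b → length (colourClass c b) ≤ length (colourClass c (not b))
      into b = subst (_≤ _) (length-map p (colourClass c b))
        (unique-⊆⇒length≤ (map⁺ p-injective (colourClass-unique c b)) image⊆)
        where
          image⊆ : ∀ {z} → z ∈ map p (colourClass c b) → z ∈ colourClass c (not b)
          image⊆ mem with ∈-map⁻ p mem
          ... | x , x∈ , refl = ∈-colourClass (p x)
                 (trans (¬-not (p-swaps x)) (cong not (colourClass-colour x∈)))

  orient : (Fin n → Bool) → Edge n → Edge n
  orient c (a , b) = if c a then (a , b) else (b , a)

  orient-SameEdge : ∀ c (e f : Edge n) → orient c e ≡ orient c f → SameEdge e f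
  orient-SameEdge c (a , b) (a' , b') eq with c a | c a'
  orient-SameEdge c (a , b) (a' , b') refl | true | true = inj₁ (refl , refl)
  orient-SameEdge c (a , b) (a' , b') refl | true | false = inj₂ (refl , refl)
  orient-SameEdge c (a , b) (a' , b') refl | false | true = inj₂ (refl , refl)
  orient-SameEdge c (a , b) (a' , b') refl | false | false = inj₁ (refl , refl)

  -- A simple graph with a proper 2-colouring has at most |T|·|F| edges: orienting edges
  -- injects them into T × F.
  bipartite-size≤ : ∀ c (G : EdgeList n) → IsSimple G → Proper c G →
                    length G ≤ length (colourClass c true) * length (colourClass c false)
  bipartite-size≤ c G (_ , distinct) proper =
    subst₂ _≤_ (length-map (orient c) G) (length-cartesianProduct (colourClass c true) (colourClass c false))
      (unique-⊆⇒length≤ (AllPairsₚ.map⁺ (AllPairs.map (λ ¬same eq → ¬same (orient-SameEdge c _ _ eq)) distinct))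
                          oriented∈)
    where
      oriented∈ : ∀ {z} → z ∈ map (orient c) G → z ∈ cartesianProduct (colourClass c true) (colourClass c false)
      oriented∈ mem with ∈-map⁻ (orient c) mem
      ... | (a , b) , ab∈G , refl with c a in ca | c b in cb | proper ab∈G
      ... | true | true | differ = ⊥-elim (differ refl)
      ... | true | false | _ = ∈-cartesianProduct⁺ (∈-colourClass a ca) (∈-colourClass b cb)
      ... | false | true | _ = ∈-cartesianProduct⁺ (∈-colourClass b cb) (∈-colourClass a ca)
      ... | false | false | differ = ⊥-elim (differ refl)

  complete-bipartite-size≥ : ∀ c (G : EdgeList n) → (∀ t f → c t ≡ true → c f ≡ false → Adj G t f) →
                             length (colourClass c true) * length (colourClass c false) ≤ length G
  complete-bipartite-size≥ c G complete =
    subst₂ _≤_ (length-cartesianProduct (colourClass c true) (colourClass c false)) (length-map (orient c) G)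
      (unique-⊆⇒length≤ (cartesianProduct⁺ (colourClass-unique c true) (colourClass-unique c false)) pair∈)
    where
      pair∈ : ∀ {z} → z ∈ cartesianProduct (colourClass c true) (colourClass c false) → z ∈ map (orient c) G
      pair∈ {t , f} mem with ∈-cartesianProduct⁻ (colourClass c true) (colourClass c false) mem
      ... | t∈T , f∈F with colourClass-colour t∈T | colourClass-colour f∈F
      ... | ct | cf with complete t f ct cf
      ... | inj₁ tf∈G =
        subst (λ b → (if b then (t , f) else (f , t)) ∈ map (orient c) G) ct (∈-map⁺ (orient c) tf∈G)
      ... | inj₂ ft∈G =
        subst (λ b → (if b then (f , t) else (t , f)) ∈ map (orient c) G) cf (∈-map⁺ (orient c) ft∈G)

  Oriented : (Fin n → Bool) → Edge n → Set
  Oriented c (a , b) = (c a ≡ true) × (c b ≡ false)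

  completeBipartite : (Fin n → Bool) → EdgeList n
  completeBipartite c = cartesianProduct (colourClass c true) (colourClass c false)

  completeBipartite-oriented : ∀ c {e} → e ∈ completeBipartite c → Oriented c e
  completeBipartite-oriented c mem with ∈-cartesianProduct⁻ (colourClass c true) (colourClass c false) mem
  ... | a∈T , b∈F = colourClass-colour a∈T , colourClass-colour b∈F

  completeBipartite-proper : ∀ c → Proper c (completeBipartite c)
  completeBipartite-proper c mem same with completeBipartite-oriented c mem
  ... | ca , cb = true≢false (trans (sym ca) (trans same cb))

  oriented⇒simple : ∀ c {G : EdgeList n} → (∀ {e} → e ∈ G → Oriented c e) → Unique G → IsSimple G
  oriented⇒simple c {[]} _ [] = [] , []
  oriented⇒simple c {(a , b) ∷ G} oriented (distinct ∷ unique)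
    with oriented⇒simple c (λ m → oriented (there m)) unique
  ... | loopless , rest =
    (loop-free ∷ loopless) ,
    (All.zipWith not-same (distinct , All.tabulate (λ m → oriented (there m))) ∷ rest)
    where
      ends = oriented (here refl)
      loop-free : a ≢ b
      loop-free refl = true≢false (trans (sym (proj₁ ends)) (proj₂ ends))
      not-same : ∀ {e} → ((a , b) ≢ e) × Oriented c e → ¬ SameEdge (a , b) e
      not-same (ab≢e , _) (inj₁ (refl , refl)) = ab≢e refl
      not-same (_ , ce₁ , _) (inj₂ (refl , refl)) = true≢false (trans (sym ce₁) (proj₂ ends))

  completeBipartite-simple : ∀ c → IsSimple (completeBipartite c)
  completeBipartite-simple c = oriented⇒simple c (completeBipartite-oriented c)
    (cartesianProduct⁺ (colourClass-unique c true) (colourClass-unique c false))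

  -- A certificate that G is bipartite, organised by connected components: every vertex
  -- carries a component label and a colour, edges stay inside components, the colouring
  -- is proper, and any two vertices with the same label are joined by a path.
  record Bipartition (G : EdgeList n) : Set where
    field
      component : Fin n → Fin n
      colour : Fin n → Bool
      edge-component : ∀ {u v} → (u , v) ∈ G → component u ≡ component v
      proper : Proper colour G
      connected : ∀ u v → component u ≡ component v → Reachable G u v

    Isolated : Fin n → Set
    Isolated x = ∀ y → component y ≡ component x → y ≡ x

    Joined : Fin n → Fin n → Set
    Joined x y = (component x ≡ component y) × (colour x ≢ colour y)

    Admissible : Fin n → Fin n → Set
    Admissible u v = component u ≡ component v → colour u ≢ colour v

    Adj-component : ∀ {u v} → Adj G u v → component u ≡ component v
    Adj-component (inj₁ p) = edge-component p
    Adj-component (inj₂ p) = sym (edge-component p)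

    path-component : ∀ {a b m xs} → Path G a b m xs → ∀ {z} → z ∈ xs → component z ≡ component a
    path-component stay (here refl) = refl
    path-component (step a _ p) (here refl) = refl
    path-component (step a _ p) (there q) = trans (path-component p q) (sym (Adj-component a))

    joined⇒¬isolated : ∀ {x y} → Joined x y → ¬ Isolated x
    joined⇒¬isolated (same , differ) isolated = differ (cong colour (sym (isolated _ (sym same))))

    -- A legal move never closes an odd cycle: if u and v lie in one component with the
    -- same colour, the path between them has even length and closes into an odd cycle.
    legal⇒admissible : ∀ {u v} → Legal G (u , v) → Admissible u v
    legal⇒admissible {u} {v} (u≢v , _ , no-odd-cycle) same-component same-colour
      with connected u v same-component
    ... | m , xs , p with flips-fixed⇒even m (colour u) (trans (sym (path-colour proper p)) (sym same-colour))
    ... | zero , refl = u≢v (path-length0 p)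
    ... | suc j , refl =
      no-odd-cycle (path+edge⇒oddCycle {j = j} (subst (λ m → Path G u v m xs) (sym (double j)) p))

  open Bipartition

  record Extends {G G' : EdgeList n} (s : Bipartition G) (s' : Bipartition G') (u v : Fin n) : Set where
    field
      keep-joined : ∀ {x y} → Joined s x y → Joined s' x y
      keep-isolated : ∀ {x} → Isolated s x → x ≢ u → x ≢ v → Isolated s' x

  Extension : ∀ {G : EdgeList n} → Bipartition G → Fin n → Fin n → Set
  Extension {G} s u v = Σ (Bipartition ((u , v) ∷ G)) λ s' → Extends s s' u v

  extend-inside : ∀ {G} (s : Bipartition G) {u v} → component s u ≡ component s v →
                  colour s u ≢ colour s v → Extension s u v
  extend-inside {G} s {u} {v} same differ =
    s' , record { keep-joined = λ j → j ; keep-isolated = λ i _ _ → i }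
    where
      s' : Bipartition ((u , v) ∷ G)
      component s' = component s
      colour s' = colour s
      edge-component s' (here refl) = same
      edge-component s' (there p) = edge-component s p
      proper s' (here refl) = differ
      proper s' (there p) = proper s p
      connected s' x y eq with connected s x y eq
      ... | m , xs , p = m , xs , path-weaken p

  xor-cancelʳ : ∀ a s → (a xor s) xor s ≡ a
  xor-cancelʳ a s = trans (xor-assoc a s s) (trans (cong (a xor_) (xor-same s)) (xor-identityʳ a))

  -- An edge between two components merges them: v's component is relabelled as u's and
  -- recoloured (by xor with a fixed bit) so that v receives the colour opposite to u.
  module Merge {G} (s : Bipartition G) (u v : Fin n) (apart : component s u ≢ component s v) where
    recolour : Bool
    recolour = colour s v xor not (colour s u)

    InV : Fin n → Set
    InV x = component s x ≡ component s v

    merged-component : Fin n → Fin n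
    merged-component x with component s x ≟ component s v
    ... | yes _ = component s u
    ... | no _ = component s x

    merged-colour : Fin n → Bool
    merged-colour x with component s x ≟ component s v
    ... | yes _ = colour s x xor recolour
    ... | no _ = colour s x

    component-inV : ∀ {x} → InV x → merged-component x ≡ component s u
    component-inV {x} x∈v with component s x ≟ component s v
    ... | yes _ = refl
    ... | no x∉v = ⊥-elim (x∉v x∈v)

    component-outV : ∀ {x} → ¬ InV x → merged-component x ≡ component s x
    component-outV {x} x∉v with component s x ≟ component s v
    ... | yes x∈v = ⊥-elim (x∉v x∈v)
    ... | no _ = refl

    colour-inV : ∀ {x} → InV x → merged-colour x ≡ colour s x xor recolour
    colour-inV {x} x∈v with component s x ≟ component s v
    ... | yes _ = refl
    ... | no x∉v = ⊥-elim (x∉v x∈v)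

    colour-outV : ∀ {x} → ¬ InV x → merged-colour x ≡ colour s x
    colour-outV {x} x∉v with component s x ≟ component s v
    ... | yes x∈v = ⊥-elim (x∉v x∈v)
    ... | no _ = refl

    keeps-component : ∀ {x y} → component s x ≡ component s y → merged-component x ≡ merged-component y
    keeps-component {x} {y} same = by-cases (component s x ≟ component s v)
      where
        by-cases : Dec (InV x) → merged-component x ≡ merged-component y
        by-cases (yes x∈v) = trans (component-inV x∈v) (sym (component-inV (trans (sym same) x∈v)))
        by-cases (no x∉v) =
          trans (component-outV x∉v) (trans same (sym (component-outV (λ y∈v → x∉v (trans same y∈v)))))

    keeps-joined : ∀ {x y} → Joined s x y →
                   (merged-component x ≡ merged-component y) × (merged-colour x ≢ merged-colour y)
    keeps-joined {x} {y} (same , differ) = keeps-component same , new-differ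
      where
        new-differ : merged-colour x ≢ merged-colour y
        new-differ eq = by-cases (component s x ≟ component s v)
          where
            by-cases : Dec (InV x) → ⊥
            by-cases (yes x∈v) = differ (begin
              colour s x                               ≡⟨ xor-cancelʳ _ recolour ⟨
              (colour s x xor recolour) xor recolour   ≡⟨ cong (_xor recolour) (colour-inV x∈v) ⟨
              merged-colour x xor recolour             ≡⟨ cong (_xor recolour) eq ⟩
              merged-colour y xor recolour             ≡⟨ cong (_xor recolour) (colour-inV y∈v) ⟩
              (colour s y xor recolour) xor recolour   ≡⟨ xor-cancelʳ _ recolour ⟩
              colour s y                               ∎)
              where
                open ≡-Reasoning
                y∈v = trans (sym same) x∈v
            by-cases (no x∉v) = differ (trans (sym (colour-outV x∉v))
              (trans eq (colour-outV (λ y∈v → x∉v (trans same y∈v)))))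

    keeps-isolated : ∀ {x} → Isolated s x → x ≢ u → x ≢ v →
                     ∀ y → merged-component y ≡ merged-component x → y ≡ x
    keeps-isolated {x} isolated x≢u x≢v y eq = isolated y (same-old-component (component s y ≟ component s v))
      where
        x∉v : ¬ InV x
        x∉v x∈v = x≢v (sym (isolated v (sym x∈v)))
        x∉u : component s x ≢ component s u
        x∉u x∈u = x≢u (sym (isolated u (sym x∈u)))
        same-old-component : Dec (InV y) → component s y ≡ component s x
        same-old-component (yes y∈v) =
          ⊥-elim (x∉u (sym (trans (sym (component-inV y∈v)) (trans eq (component-outV x∉v)))))
        same-old-component (no y∉v) = trans (sym (component-outV y∉v)) (trans eq (component-outV x∉v))

    new-edge-colours : merged-colour u ≢ merged-colour v
    new-edge-colours eq = not-¬ refl (begin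
      colour s u                                         ≡⟨ colour-outV apart ⟨
      merged-colour u                                    ≡⟨ eq ⟩
      merged-colour v                                    ≡⟨ colour-inV refl ⟩
      colour s v xor (colour s v xor not (colour s u))   ≡⟨ xor-assoc (colour s v) _ _ ⟨
      (colour s v xor colour s v) xor not (colour s u)   ≡⟨ cong (_xor not (colour s u)) (xor-same (colour s v)) ⟩
      not (colour s u)                                   ∎)
      where open ≡-Reasoning

    -- Vertices on opposite sides of the new edge are connected through it.
    merged : Bipartition ((u , v) ∷ G)
    component merged = merged-component
    colour merged = merged-colour
    edge-component merged (here refl) = trans (component-outV apart) (sym (component-inV refl))
    edge-component merged (there p) = keeps-component (edge-component s p)
    proper merged (here refl) = new-edge-colours
    proper merged (there p) = proj₂ (keeps-joined (edge-component s p , proper s p))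
    connected merged x y eq = join (component s x ≟ component s v) (component s y ≟ component s v)
      where
        old-path : ∀ {a b} → component s a ≡ component s b → Reachable ((u , v) ∷ G) a b
        old-path eq' with connected s _ _ eq'
        ... | m , xs , p = m , xs , path-weaken p
        -- paths on the two sides of the new edge are vertex-disjoint, so they concatenate
        bridge : ∀ {a w w' b} → component s a ≡ component s w → Adj ((u , v) ∷ G) w w' →
                 component s w' ≡ component s b → component s w ≢ component s w' →
                 Reachable ((u , v) ∷ G) a b
        bridge a~w w-w' w'~b sides-apart with connected s _ _ a~w | connected s _ _ w'~b
        ... | m , xs , p | m' , ys , q =
          _ , _ , path-join (path-weaken p) w-w' (path-weaken q)
            (λ z∈xs z∈ys → sides-apart (trans (sym (trans (path-component s p z∈xs) a~w))
                                              (path-component s q z∈ys)))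
        join : Dec (InV x) → Dec (InV y) → Reachable ((u , v) ∷ G) x y
        join (yes x∈v) (yes y∈v) = old-path (trans x∈v (sym y∈v))
        join (no x∉v) (no y∉v) = old-path (trans (sym (component-outV x∉v)) (trans eq (component-outV y∉v)))
        join (no x∉v) (yes y∈v) =
          bridge (trans (sym (component-outV x∉v)) (trans eq (component-inV y∈v))) (inj₁ (here refl))
                 (sym y∈v) apart
        join (yes x∈v) (no y∉v) =
          bridge x∈v (inj₂ (here refl))
                 (sym (trans (sym (component-outV y∉v)) (trans (sym eq) (component-inV x∈v))))
                 (λ e → apart (sym e))

  extend : ∀ {G} (s : Bipartition G) {u v} → Admissible s u v → Extension s u v
  extend s {u} {v} admissible with component s u ≟ component s v
  ... | yes same = extend-inside s same (admissible same)
  ... | no apart =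
    merged , record { keep-joined = keeps-joined ; keep-isolated = λ i x≢u x≢v → keeps-isolated i x≢u x≢v }
    where open Merge s u v apart

  play : ∀ {G} (s : Bipartition G) e → Legal G e → Bipartition (e ∷ G)
  play s (u , v) legal = proj₁ (extend s (legal⇒admissible s legal))

  play-extends : ∀ {G} (s : Bipartition G) {u v} (legal : Legal G (u , v)) →
                 Extends s (play s (u , v) legal) u v
  play-extends s legal = proj₂ (extend s (legal⇒admissible s legal))

  new-edge-joined : ∀ {G u v} (s : Bipartition ((u , v) ∷ G)) → Joined s u v
  new-edge-joined s = edge-component s (here refl) , proper s (here refl)

  admissible⇒legal : ∀ {G} (s : Bipartition G) {u v} → u ≢ v → ¬ Adj G u v → Admissible s u v →
                     Legal G (u , v)
  admissible⇒legal s u≢v new admissible = u≢v , new , proper⇒oddCycleFree (proper (proj₁ (extend s admissible)))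

  Adj? : (G : EdgeList n) → ∀ u v → Dec (Adj G u v)
  Adj? G u v = ((u , v) ∈? G) ⊎-dec ((v , u) ∈? G)
    where open import Data.List.Membership.DecPropositional (≡-dec _≟_ _≟_) using (_∈?_)

  -- Whether the game is over is decidable: search all pairs for an admissible new edge.
  legal-or-over : ∀ {G} → Bipartition G → GameOver G ⊎ Σ (Edge n) (Legal G)
  legal-or-over {G} s with any? (λ u → any? (λ v → candidate? u v))
    where
      candidate? : ∀ u v → Dec ((u ≢ v) × ¬ Adj G u v × Admissible s u v)
      candidate? u v = ¬? (u ≟ v) ×-dec ¬? (Adj? G u v) ×-dec
                       ((component s u ≟ component s v) →-dec ¬? (colour s u Bool.≟ colour s v))
  ... | yes (u , v , u≢v , new , admissible) = inj₂ ((u , v) , admissible⇒legal s u≢v new admissible)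
  ... | no none =
    inj₁ λ { (u , v) legal → none (u , v , proj₁ legal , proj₁ (proj₂ legal) , legal⇒admissible s legal) }

  simple-∷ : ∀ {G : EdgeList n} {u v} → IsSimple G → Legal G (u , v) → IsSimple ((u , v) ∷ G)
  simple-∷ {G} {u} {v} (loopless , distinct) (u≢v , new , _) =
    (u≢v ∷ loopless) , (All.tabulate differs ∷ distinct)
    where
      differs : ∀ {e} → e ∈ G → ¬ SameEdge (u , v) e
      differs e∈G (inj₁ (refl , refl)) = new (inj₁ e∈G)
      differs e∈G (inj₂ (refl , refl)) = new (inj₂ e∈G)

  emptyBipartition : Bipartition []
  component emptyBipartition x = x
  colour emptyBipartition x = true
  edge-component emptyBipartition ()
  proper emptyBipartition ()
  connected emptyBipartition u v refl = 0 , (u ∷ []) , stay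

  bipartition-of : (G : EdgeList n) → IsSimple G → OddCycleFree G → Bipartition G
  bipartition-of [] _ _ = emptyBipartition
  bipartition-of ((u , v) ∷ G) (u≢v ∷ loopless , new ∷ distinct) no-odd-cycle =
    play s (u , v) (u≢v , not-adjacent , no-odd-cycle)
    where
      s = bipartition-of G (loopless , distinct) λ (j , c , c-inj , adj , closing) →
            no-odd-cycle (j , c , c-inj , (λ i → Adj-weaken (adj i)) , Adj-weaken closing)
      not-adjacent : ¬ Adj G u v
      not-adjacent (inj₁ e∈G) = All.lookup new e∈G (inj₁ (refl , refl))
      not-adjacent (inj₂ e∈G) = All.lookup new e∈G (inj₂ (refl , refl))

  record Matching (p : Fin n → Fin n) : Set where
    field
      involutive : ∀ x → p (p x) ≡ x
      no-fixed-point : ∀ x → p x ≢ x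

    injective : ∀ {x y} → p x ≡ p y → x ≡ y
    injective {x} {y} eq = trans (sym (involutive x)) (trans (cong p eq) (involutive y))

    partner-≢ : ∀ {x a} → x ≢ p a → p x ≢ a
    partner-≢ {x} x≢pa refl = x≢pa (sym (involutive x))

  open Matching

  transpose-left : ∀ (i j : Fin n) → transpose i j i ≡ j
  transpose-left i j rewrite dec-true (i ≟ i) refl = refl

  transpose-right : ∀ {i j : Fin n} → i ≢ j → transpose i j j ≡ i
  transpose-right {i} {j} i≢j rewrite dec-false (j ≟ i) (≢-sym i≢j) | dec-true (j ≟ j) refl = refl

  transpose-other : ∀ {i j x : Fin n} → x ≢ i → x ≢ j → transpose i j x ≡ x
  transpose-other {i} {j} {x} x≢i x≢j rewrite dec-false (x ≟ i) x≢i | dec-false (x ≟ j) x≢j = refl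

  -- Re-pairing: from p, pass to the matching pairing u with v and p u with p v, obtained
  -- by conjugating p with the transposition of p u and v.
  rematch : ∀ {p} → Matching p → ∀ {u v} → u ≢ v → v ≢ p u →
            Σ (Fin n → Fin n) λ q → Matching q × (q u ≡ v) × (q (p u) ≡ p v) ×
                                   (∀ x → x ≢ u → x ≢ v → x ≢ p u → x ≢ p v → q x ≡ p x)
  rematch {p} m {u} {v} u≢v v≢pu =
    q , record { involutive = q-involutive ; no-fixed-point = q-no-fixed-point } , q-u , q-pu , q-other
    where
      a = p u
      q : Fin n → Fin n
      q x = transpose a v (p (transpose v a x))
      q-involutive : ∀ x → q (q x) ≡ x
      q-involutive x rewrite transpose-inverse v a {p (transpose v a x)} | involutive m (transpose v a x) =
        transpose-inverse a v
      q-no-fixed-point : ∀ x → q x ≢ x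
      q-no-fixed-point x eq =
        no-fixed-point m (transpose v a x) (trans (sym (transpose-inverse v a)) (cong (transpose v a) eq))
      u≢a : u ≢ a
      u≢a = ≢-sym (no-fixed-point m u)
      pv≢a : p v ≢ a
      pv≢a pv≡pu = u≢v (sym (injective m pv≡pu))
      pv≢v : p v ≢ v
      pv≢v = no-fixed-point m v
      q-u : q u ≡ v
      q-u rewrite transpose-other {v} {a} u≢v u≢a = transpose-left a v
      q-pu : q a ≡ p v
      q-pu rewrite transpose-right {v} {a} v≢pu = transpose-other pv≢a pv≢v
      q-other : ∀ x → x ≢ u → x ≢ v → x ≢ p u → x ≢ p v → q x ≡ p x
      q-other x x≢u x≢v x≢pu x≢pv rewrite transpose-other {v} {a} x≢v x≢pu =
        transpose-other (λ px≡a → x≢u (injective m px≡a)) (partner-≢ m x≢pv)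

  -- Max's invariant for a pair {x, y} of the matching: it is joined, or both of its
  -- vertices are still isolated.
  Paired : ∀ {G} → Bipartition G → Fin n → Fin n → Set
  Paired s x y = Joined s x y ⊎ (Isolated s x × Isolated s y)

  Paired-sym : ∀ {G} {s : Bipartition G} {x y} → Paired s x y → Paired s y x
  Paired-sym (inj₁ (same , differ)) = inj₁ (sym same , ≢-sym differ)
  Paired-sym (inj₂ (ix , iy)) = inj₂ (iy , ix)

  Invariant : ∀ {G} → Bipartition G → (Fin n → Fin n) → Set
  Invariant s p = ∀ x → Paired s x (p x)

  -- The invariant after Min has touched the isolated pair {w, p w} at w only.
  AllPairedBut : ∀ {G} → Bipartition G → (Fin n → Fin n) → Fin n → Set
  AllPairedBut s p w = (∀ x → x ≢ w → x ≢ p w → Paired s x (p x)) × Isolated s (p w)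

  -- The state in which Max is about to move.
  MaxReady : ∀ {G} → Bipartition G → (Fin n → Fin n) → Set
  MaxReady s p = Invariant s p ⊎ Σ (Fin n) (AllPairedBut s p)

  Off : Fin n → Fin n → Fin n → Set
  Off u v z = (z ≢ u) × (z ≢ v)

  isolated-≢ : ∀ {G} (s : Bipartition G) {z w} → Isolated s z → ¬ Isolated s w → z ≢ w
  isolated-≢ s iz ¬iw refl = ¬iw iz

  paired-preserved : ∀ {G G'} {s : Bipartition G} {s' : Bipartition G'} {u v x y} → Extends s s' u v →
                     Paired s x y → (Isolated s x → Isolated s y → Off u v x × Off u v y) → Paired s' x y
  paired-preserved ext (inj₁ joined) _ = inj₁ (Extends.keep-joined ext joined)
  paired-preserved ext (inj₂ (ix , iy)) off with off ix iy
  ... | (x≢u , x≢v) , (y≢u , y≢v) =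
    inj₂ (Extends.keep-isolated ext ix x≢u x≢v , Extends.keep-isolated ext iy y≢u y≢v)

  invariant-by-pair : ∀ {G} {s : Bipartition G} {p} → Matching p → ∀ w → Paired s w (p w) →
                      (∀ x → x ≢ w → x ≢ p w → Paired s x (p x)) → Invariant s p
  invariant-by-pair {s = s} {p} m w pw others x with x ≟ w | x ≟ p w
  ... | yes refl | _ = pw
  ... | no _ | yes refl = subst (Paired s (p w)) (sym (involutive m w)) (Paired-sym {s = s} pw)
  ... | no x≢w | no x≢pw = others x x≢w x≢pw

  join-pair : ∀ {G} (s : Bipartition G) {p} → Matching p → ∀ w → AllPairedBut s p w →
              Σ (Legal G (p w , w)) λ legal → Invariant (play s (p w , w) legal) p
  join-pair {G} s {p} m w (others , ipw) =
    legal , invariant-by-pair {s = s'} m w (Paired-sym {s = s'} (inj₁ (new-edge-joined s')))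
    λ x x≢w x≢pw → paired-preserved (play-extends s legal) (others x x≢w x≢pw)
      λ _ _ → (x≢pw , x≢w) , ((λ px≡pw → x≢w (injective m px≡pw)) , partner-≢ m x≢pw)
    where
      apart : component s (p w) ≢ component s w
      apart same = no-fixed-point m w (sym (ipw w (sym same)))
      legal : Legal G (p w , w)
      legal = admissible⇒legal s (no-fixed-point m w) (apart ∘ Adj-component s) (⊥-elim ∘ apart)
      s' = play s (p w , w) legal

  isolated-pair-or-all-joined : ∀ {G} (s : Bipartition G) {p} → Matching p → Invariant s p →
                                Σ (Fin n) (AllPairedBut s p) ⊎ (∀ x → Joined s x (p x))
  isolated-pair-or-all-joined s {p} m inv with any? (λ x → ¬? (component s x ≟ component s (p x)))
  ... | yes (w , apart) = inj₁ (w , (λ x _ _ → inv x) , isolated-partner (inv w))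
    where
      isolated-partner : Paired s w (p w) → Isolated s (p w)
      isolated-partner (inj₁ (same , _)) = ⊥-elim (apart same)
      isolated-partner (inj₂ (_ , ipw)) = ipw
  ... | no none = inj₂ λ x → joined x (inv x)
    where
      joined : ∀ x → Paired s x (p x) → Joined s x (p x)
      joined x (inj₁ j) = j
      joined x (inj₂ (ix , _)) = ⊥-elim (none (x , λ same → no-fixed-point m x (ix (p x) (sym same))))

  module AfterMinMove {G} (s : Bipartition G) {p} (m : Matching p) (inv : Invariant s p)
                      {u v} (legal : Legal G (u , v)) where
    s' = play s (u , v) legal
    ext = play-extends s legal

    -- Min joined two vertices of joined pairs: no isolated pair is touched.
    both-joined : ¬ Isolated s u → ¬ Isolated s v → Invariant s' p
    both-joined ¬iu ¬iv x = paired-preserved ext (inv x) λ ix ipx → off ix , off ipx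
      where
        off : ∀ {z} → Isolated s z → Off u v z
        off iz = isolated-≢ s iz ¬iu , isolated-≢ s iz ¬iv

    -- Min touched the isolated pair {u, p u} at u: Max will join p u to u.
    left-isolated : Isolated s (p u) → ¬ Isolated s v → AllPairedBut s' p u
    left-isolated ipu ¬iv =
      (λ x x≢u x≢pu → paired-preserved ext (inv x) λ ix ipx →
         (x≢u , isolated-≢ s ix ¬iv) , (partner-≢ m x≢pu , isolated-≢ s ipx ¬iv)) ,
      Extends.keep-isolated ext ipu (no-fixed-point m u) (isolated-≢ s ipu ¬iv)

    right-isolated : ¬ Isolated s u → Isolated s (p v) → AllPairedBut s' p v
    right-isolated ¬iu ipv =
      (λ x x≢v x≢pv → paired-preserved ext (inv x) λ ix ipx →
         (isolated-≢ s ix ¬iu , x≢v) , (isolated-≢ s ipx ¬iu , partner-≢ m x≢pv)) ,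
      Extends.keep-isolated ext ipv (isolated-≢ s ipv ¬iu) (no-fixed-point m v)

    partners : v ≡ p u → Invariant s' p
    partners refl = invariant-by-pair {s = s'} m u (inj₁ (new-edge-joined s')) λ x x≢u x≢pu →
      paired-preserved ext (inv x) λ _ _ →
        (x≢u , x≢pu) , (partner-≢ m x≢pu , (λ px≡pu → x≢u (injective m px≡pu)))

    -- Min joined isolated vertices of two different pairs: re-pair u with v and p u with
    -- p v; the latter pair is still isolated.
    strangers : Isolated s (p u) → Isolated s (p v) → v ≢ p u →
                Σ (Fin n → Fin n) λ q → Matching q × Invariant s' q
    strangers ipu ipv v≢pu with rematch m (proj₁ legal) v≢pu
    ... | q , mq , q-u , q-pu , q-other =
      q , mq , invariant-by-pair {s = s'} mq u
                 (subst (Paired s' u) (sym q-u) (inj₁ (new-edge-joined s'))) others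
      where
        pu≢v : p u ≢ v
        pu≢v = ≢-sym v≢pu
        pv≢u : p v ≢ u
        pv≢u = partner-≢ m v≢pu
        ipu' : Isolated s' (p u)
        ipu' = Extends.keep-isolated ext ipu (no-fixed-point m u) pu≢v
        ipv' : Isolated s' (p v)
        ipv' = Extends.keep-isolated ext ipv pv≢u (no-fixed-point m v)
        q-pv : q (p v) ≡ p u
        q-pv = trans (cong q (sym q-pu)) (involutive mq (p u))
        others : ∀ x → x ≢ u → x ≢ q u → Paired s' x (q x)
        others x x≢u x≢qu with x ≟ p u | x ≟ p v
        ... | yes refl | _ = subst (Paired s' (p u)) (sym q-pu) (inj₂ (ipu' , ipv'))
        ... | no _ | yes refl = subst (Paired s' (p v)) (sym q-pv) (inj₂ (ipv' , ipu'))
        ... | no x≢pu | no x≢pv = subst (Paired s' x) (sym (q-other x x≢u x≢v x≢pu x≢pv))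
              (paired-preserved ext (inv x) λ _ _ →
                (x≢u , x≢v) , (partner-≢ m x≢pu , partner-≢ m x≢pv))
          where
            x≢v : x ≢ v
            x≢v x≡v = x≢qu (trans x≡v (sym q-u))

    restore : Σ (Fin n → Fin n) λ q → Matching q × MaxReady s' q
    restore with inv u | inv v
    ... | inj₁ ju | inj₁ jv = p , m , inj₁ (both-joined (joined⇒¬isolated s ju) (joined⇒¬isolated s jv))
    ... | inj₂ (_ , ipu) | inj₁ jv = p , m , inj₂ (u , left-isolated ipu (joined⇒¬isolated s jv))
    ... | inj₁ ju | inj₂ (_ , ipv) = p , m , inj₂ (v , right-isolated (joined⇒¬isolated s ju) ipv)
    ... | inj₂ (_ , ipu) | inj₂ (_ , ipv) with v ≟ p u
    ...   | yes v≡pu = p , m , inj₁ (partners v≡pu)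
    ...   | no v≢pu with strangers ipu ipv v≢pu
    ...     | q , mq , inv' = q , mq , inj₁ inv'

  -- At the end of the game no pair can still be isolated (joining it would be legal) ...
  over⇒all-joined : ∀ {G} (s : Bipartition G) {p} → GameOver G → Matching p → Invariant s p →
                    ∀ x → Joined s x (p x)
  over⇒all-joined {G} s {p} finished m inv x with inv x
  ... | inj₁ joined = joined
  ... | inj₂ (ix , ipx) =
    ⊥-elim (finished (x , p x) (admissible⇒legal s x≢px (apart ∘ Adj-component s) (⊥-elim ∘ apart)))
    where
      x≢px : x ≢ p x
      x≢px = ≢-sym (no-fixed-point m x)
      apart : component s x ≢ component s (p x)
      apart same = x≢px (sym (ix (p x) (sym same)))

  -- ... and every pair of opposite colours is adjacent (adding it would be legal).
  over⇒complete : ∀ {G} (s : Bipartition G) → GameOver G →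
                  ∀ t f → colour s t ≡ true → colour s f ≡ false → Adj G t f
  over⇒complete {G} s finished t f ct cf with Adj? G t f
  ... | yes adj = adj
  ... | no ¬adj = ⊥-elim (finished (t , f) (admissible⇒legal s t≢f ¬adj λ _ same-colour →
                  true≢false (trans (sym ct) (trans same-colour cf))))
    where
      t≢f : t ≢ f
      t≢f t≡f = true≢false (trans (sym ct) (trans (cong (colour s) t≡f) cf))

data Even : ℕ → Set where
  even-zero : Even 0
  even-suc-suc : ∀ {m} → Even m → Even (suc (suc m))

even-double : ∀ k → Even (2 * k)
even-double zero = even-zero
even-double (suc k) = subst Even (cong suc (sym (+-suc k (k + 0)))) (even-suc-suc (even-double k))

pairSwap : ∀ {m} → Fin m → Fin m
pairSwap {suc zero} fzero = fzero
pairSwap {suc (suc m)} fzero = fsuc fzero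
pairSwap {suc (suc m)} (fsuc fzero) = fzero
pairSwap {suc (suc m)} (fsuc (fsuc i)) = fsuc (fsuc (pairSwap i))

parity : ∀ {m} → Fin m → Bool
parity {suc zero} fzero = true
parity {suc (suc m)} fzero = true
parity {suc (suc m)} (fsuc fzero) = false
parity {suc (suc m)} (fsuc (fsuc i)) = parity i

pairSwap-matching : ∀ {m} → Even m → Matching {m} pairSwap
pairSwap-matching {m} even = record { involutive = involutive ; no-fixed-point = no-fixed-point even }
  where
    involutive : ∀ {m} (x : Fin m) → pairSwap (pairSwap x) ≡ x
    involutive {suc zero} fzero = refl
    involutive {suc (suc m)} fzero = refl
    involutive {suc (suc m)} (fsuc fzero) = refl
    involutive {suc (suc m)} (fsuc (fsuc i)) = cong (λ z → fsuc (fsuc z)) (involutive i)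
    no-fixed-point : ∀ {m} → Even m → (x : Fin m) → pairSwap x ≢ x
    no-fixed-point (even-suc-suc _) fzero ()
    no-fixed-point (even-suc-suc _) (fsuc fzero) ()
    no-fixed-point (even-suc-suc even) (fsuc (fsuc i)) eq =
      no-fixed-point even i (suc-injective (suc-injective eq))

parity-pairSwap : ∀ {m} → Even m → (x : Fin m) → parity (pairSwap x) ≢ parity x
parity-pairSwap (even-suc-suc _) fzero ()
parity-pairSwap (even-suc-suc _) (fsuc fzero) ()
parity-pairSwap (even-suc-suc even) (fsuc (fsuc i)) = parity-pairSwap even i

module Game (k : ℕ) where
  open Bipartition
  open Matching

  2k≡k+k : 2 * k ≡ k + k
  2k≡k+k = cong (k +_) (+-identityʳ k)

  bipartite-size≤k² : ∀ {c} {G : EdgeList (2 * k)} → IsSimple G → Proper c G → length G ≤ k * k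
  bipartite-size≤k² {c} {G} simple proper =
    ≤-trans (bipartite-size≤ c G simple proper)
            (product≤square (length (colourClass c true)) (length (colourClass c false)) k
                            (trans (colourClass-sizes c) 2k≡k+k))

  balanced-classes : ∀ c {p} → Matching p → (∀ x → c (p x) ≢ c x) →
                     (length (colourClass c true) ≡ k) × (length (colourClass c false) ≡ k)
  balanced-classes c {p} m swaps = T≡k , trans (sym T≡F) T≡k
    where
      T = length (colourClass c true)
      T≡F : T ≡ length (colourClass c false)
      T≡F = colourClasses-equal c p (injective m) swaps
      T≡k : T ≡ k
      T≡k = half T k (trans (cong (T +_) T≡F) (trans (colourClass-sizes c) 2k≡k+k))

  -- If Max's invariant holds when the game ends, the colour classes are balanced and all
  -- k² edges between them are present.
  final-size : ∀ {G : EdgeList (2 * k)} (s : Bipartition G) {p} → GameOver G → Matching p → Invariant s p →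
               k * k ≤ length G
  final-size {G} s finished m inv =
    subst (_≤ length G) (cong₂ _*_ T≡k F≡k) (complete-bipartite-size≥ (colour s) G (over⇒complete s finished))
    where
      balanced = balanced-classes (colour s) m (λ x → ≢-sym (proj₂ (over⇒all-joined s finished m inv x)))
      T≡k = proj₁ balanced
      F≡k = proj₂ balanced

  -- Termination measure: at most f further moves can be played from G.
  Budget : EdgeList (2 * k) → ℕ → Set
  Budget G f = k * k ≤ length G + f

  budget-spend : ∀ G e {f} → Budget G (suc f) → Budget (e ∷ G) f
  budget-spend G e {f} budget = subst (k * k ≤_) (+-suc (length G) f) budget

  -- With no budget left there is no legal move: it would give a bipartite graph with
  -- more than k² edges.
  budget-exhausted : ∀ {G e} (s : Bipartition G) → IsSimple G → Budget G 0 → ¬ Legal G e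
  budget-exhausted {G} {u , v} s simple budget legal =
    <-irrefl refl (≤-trans (bipartite-size≤k² (simple-∷ simple legal) (proper (play s (u , v) legal)))
                           (subst (k * k ≤_) (+-identityʳ _) budget))

  -- Min's side: Min plays any legal move; every play ends with at most k² edges, whoever
  -- moves.
  min-strategy : ∀ f p {G} → Bipartition G → IsSimple G → Budget G f → MinForces (k * k) p G
  min-strategy f p {G} s simple budget with legal-or-over s
  ... | inj₁ finished = over finished (bipartite-size≤k² simple (proper s))
  min-strategy zero p s simple budget | inj₂ (_ , legal) = ⊥-elim (budget-exhausted s simple budget legal)
  min-strategy (suc f) Min {G} s simple budget | inj₂ ((u , v) , legal) =
    minMv (u , v) legal
      (min-strategy f Max (play s (u , v) legal) (simple-∷ simple legal) (budget-spend G (u , v) budget))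
  min-strategy (suc f) Max {G} s simple budget | inj₂ (e₀ , legal₀) =
    maxMv e₀ legal₀ λ { (u , v) legal →
      min-strategy f Min (play s (u , v) legal) (simple-∷ simple legal) (budget-spend G (u , v) budget) }

  mutual
    -- Max's turn: complete a half-touched or isolated pair if there is one, otherwise any
    -- move keeps all pairs joined.
    max-strategy : ∀ f {G} (s : Bipartition G) → IsSimple G → ∀ {p} → Matching p → MaxReady s p →
                   Budget G f → MaxForces (k * k) Max G
    max-strategy f s simple m (inj₂ (w , almost)) budget = join-isolated-pair f s simple m w almost budget
    max-strategy f s simple m (inj₁ inv) budget with isolated-pair-or-all-joined s m inv
    ... | inj₁ (w , almost) = join-isolated-pair f s simple m w almost budget
    ... | inj₂ all-joined with legal-or-over s
    ...   | inj₁ finished = over finished (final-size s finished m inv)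
    ...   | inj₂ ((u , v) , legal) = max-move f s simple m legal
              (λ x → inj₁ (Extends.keep-joined (play-extends s legal) (all-joined x))) budget

    join-isolated-pair : ∀ f {G} (s : Bipartition G) → IsSimple G → ∀ {p} → Matching p → ∀ w →
                         AllPairedBut s p w → Budget G f → MaxForces (k * k) Max G
    join-isolated-pair f s simple {p} m w almost budget with join-pair s m w almost
    ... | legal , inv = max-move f s simple m legal inv budget

    max-move : ∀ f {G} (s : Bipartition G) → IsSimple G → ∀ {p} → Matching p →
               ∀ {u v} (legal : Legal G (u , v)) → Invariant (play s (u , v) legal) p → Budget G f → MaxForces (k * k) Max G
    max-move zero s simple m legal _ budget = ⊥-elim (budget-exhausted s simple budget legal)
    max-move (suc f) {G} s simple m {u} {v} legal inv budget =
      maxMv (u , v) legal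
        (min-turn f (play s (u , v) legal) (simple-∷ simple legal) m inv (budget-spend G (u , v) budget))

    min-turn : ∀ f {G} (s : Bipartition G) → IsSimple G → ∀ {p} → Matching p → Invariant s p →
               Budget G f → MaxForces (k * k) Min G
    min-turn f s simple m inv budget with legal-or-over s
    ... | inj₁ finished = over finished (final-size s finished m inv)
    min-turn zero s simple m inv budget | inj₂ (_ , legal) = ⊥-elim (budget-exhausted s simple budget legal)
    min-turn (suc f) {G} s simple m inv budget | inj₂ (e₀ , legal₀) =
      minMv e₀ legal₀ λ { (u , v) legal → respond legal }
      where
        respond : ∀ {u v} (legal : Legal G (u , v)) → MaxForces (k * k) Max ((u , v) ∷ G)
        respond {u} {v} legal with AfterMinMove.restore s m inv legal
        ... | q , mq , ready =
          max-strategy f (play s (u , v) legal) (simple-∷ simple legal) mq ready (budget-spend G (u , v) budget)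

  K-k-k : EdgeList (2 * k)
  K-k-k = completeBipartite parity

  K-k-k-size : length K-k-k ≡ k * k
  K-k-k-size = trans (length-cartesianProduct (colourClass {2 * k} parity true) (colourClass parity false))
                     (cong₂ _*_ (proj₁ balanced) (proj₂ balanced))
    where
      balanced = balanced-classes parity (pairSwap-matching {2 * k} (even-double k))
                                  (parity-pairSwap (even-double k))

  empty-invariant : Invariant {2 * k} emptyBipartition pairSwap
  empty-invariant x = inj₂ ((λ _ eq → eq) , (λ _ eq → eq))

mainTheorem1 : (k : ℕ) → 1 ≤ k →
    GameValue Max (2 * k) (k * k) × GameValue Min (2 * k) (k * k) × ExValue (2 * k) (k * k)
mainTheorem1 k _ =
  (max-strategy (k * k) emptyBipartition empty-simple pairing (inj₁ empty-invariant) ≤-refl ,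
   min-strategy (k * k) Max emptyBipartition empty-simple ≤-refl) ,
  (min-turn (k * k) emptyBipartition empty-simple pairing empty-invariant ≤-refl ,
   min-strategy (k * k) Min emptyBipartition empty-simple ≤-refl) ,
  (K-k-k , completeBipartite-simple parity ,
   proper⇒oddCycleFree (completeBipartite-proper parity) , K-k-k-size) ,
  (λ G simple no-odd-cycle →
     bipartite-size≤k² simple (Bipartition.proper (bipartition-of G simple no-odd-cycle)))
  where
    open Game k
    empty-simple : IsSimple {2 * k} []
    empty-simple = [] , []
    pairing : Matching pairSwap
    pairing = pairSwap-matching (even-double k)
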